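{- There is an absolute constant $C$ such that the following holds. Let $q\geq C$ be a prime power and $E \subset \mathbb{F}_q^2$ with $|E| \geq 64 q \log_2 q$. Then pairs of distinct points of $E$ generate at least $\frac{q^2}{8}$ distinct straight lines in $\mathbb{F}_q^2$. Moreover, there exist a point $z\in E$ and at least $\frac{q}{4}$ straight lines incident to $z$, each of which contains at least $\frac{1}{2}\frac{|E|}{q}$ and fewer than $2\frac{|E|}{q}$ points of $E$ other than $z$.
   Context: A straight line in $\mathbb{F}_q^2$ is a set of the form $\{a+sb: s\in\mathbb{F}_q\}$ with $a\in\mathbb{F}_q^2$, $b\in\mathbb{F}_q^2\setminus\{0\}$. A line is generated by a pair of distinct points if it contains both. -}

module Defs where

open import Level using (0ℓ)
open import Data.Nat using (ℕ; suc; _^_)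
open import Data.Nat.Primality using (Prime)
open import Data.Fin using (Fin)
open import Data.Product using (Σ; ∃; _×_; _,_)
open import Data.List using (List; length)
open import Data.List.Relation.Unary.Unique.Propositional using (Unique)
open import Data.List.Membership.Propositional using (_∈_)
open import Relation.Binary.PropositionalEquality using (_≡_; _≢_)
open import Relation.Nullary using (¬_)
open import Algebra.Core using (Op₁; Op₂)
import Algebra.Structures as S
open import Function.Bundles using (_⇔_)

IsPrimePower : ℕ → Set
IsPrimePower q = Σ ℕ λ p → Σ ℕ λ k → Prime p × q ≡ p ^ suc k

-- A field structure whose carrier is Fin q (every finite field of order q
-- is isomorphic to one of these), with propositional equality.
record FieldOn (q : ℕ) : Set where
  field
    _+_ _*_ : Op₂ (Fin q)
    -_      : Op₁ (Fin q)
    0# 1#   : Fin q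
    isCommutativeRing : S.IsCommutativeRing {A = Fin q} _≡_ _+_ _*_ -_ 0# 1#
    0≢1     : 0# ≢ 1#
    inverse : ∀ x → x ≢ 0# → Σ (Fin q) λ y → x * y ≡ 1#

module Plane {q : ℕ} (F : FieldOn q) where
  open FieldOn F

  Point : Set
  Point = Fin q × Fin q

  _⊕_ : Point → Point → Point
  (a₁ , a₂) ⊕ (b₁ , b₂) = (a₁ + b₁ , a₂ + b₂)

  _·_ : Fin q → Point → Point
  s · (b₁ , b₂) = (s * b₁ , s * b₂)

  origin : Point
  origin = (0# , 0#)

  -- a line is given by a base point a and a nonzero direction b;
  -- as a set it is {a + s b : s ∈ F_q}
  record Line : Set where
    constructor line
    field
      base : Point
      dir  : Point
      dir≢0 : dir ≢ origin

  _∈L_ : Point → Line → Set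
  p ∈L line a b _ = Σ (Fin q) λ s → p ≡ a ⊕ (s · b)

  SameLine : Line → Line → Set
  SameLine L M = ∀ p → (p ∈L L) ⇔ (p ∈L M)

  PairwiseDistinct : List Line → Set
  PairwiseDistinct Ls = ∀ {i j : Fin (length Ls)} →
    i ≢ j → ¬ SameLine (Data.List.lookup Ls i) (Data.List.lookup Ls j)

  GeneratedBy : List Point → Line → Set
  GeneratedBy E L = Σ Point λ x → Σ Point λ y →
    x ∈ E × y ∈ E × x ≢ y × x ∈L L × y ∈L L

  CountOn : List Point → Point → Line → ℕ → Set
  CountOn E z L k = Σ (List Point) λ xs → Unique xs ×
    (∀ p → (p ∈ xs) ⇔ (p ∈ E × p ≢ z × p ∈L L)) × length xs ≡ k

module Submission where

-- The proof is the second-moment method. The (q + 1)·q lines are indexed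
-- by a direction d and a level c of a linear form; let a(d, c) be the
-- number of points of E on the line. Since each direction partitions the
-- plane, ∑ a = (q + 1)·N; since two distinct points lie on exactly one
-- common line, ∑ a² ≤ N·(N + q). Together these give the variance bound
-- ∑ (q·a − N)² ≤ q³·N. Assume N ≥ 64 q (a consequence of q^(64q) ≤ 2^N).
--  * A line with a ≤ 1 has (q·a − N)² ≥ N²/4, so at most q²/16 lines are
--    sparse: at least q²/8 lines are generated by pairs of points of E.
--  * An unbalanced line (a − 1 outside [N/(2q), 2N/q)) has
--    (q·a − N)² ≥ q·a·N/16, so at most 16 q² incidences lie on unbalanced
--    lines. The remaining ≥ q·N/4 incidences, counted point by point, give a
--    point z ∈ E on at least q/4 balanced lines.
-- The file develops finite sums (FiniteSums), the arithmetic of deviations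
-- and the variance bound (Deviation), coordinates on the lines of the plane
-- (LineCoordinates), and the incidence moments with both consequences
-- (Incidences); the theorem is assembled at the end.

open import Defs
import Data.Nat as ℕ
open ℕ using (ℕ)
open import Data.List using (List)
open import Data.List.Relation.Unary.Unique.Propositional using (Unique)

module FiniteSums where
  open import Data.Nat
  open import Data.Nat.Properties
  open import Data.Nat.Tactic.RingSolver using (solve-∀)
  open import Data.List using (List; []; _∷_; _++_; length; filter; map; cartesianProduct; lookup)
  open import Data.List.Relation.Unary.All as All using (All; []; _∷_)
  open import Data.List.Relation.Unary.All.Properties using (¬All⇒Any¬)
  open import Data.List.Relation.Unary.AllPairs using (AllPairs; []; _∷_)
  open import Data.List.Relation.Unary.Any using (here; there)
  open import Data.List.Relation.Unary.Unique.Propositional using (Unique)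
  open import Data.List.Membership.Propositional using (_∈_; find)
  open import Data.List.Membership.Propositional.Properties using (∈-lookup)
  open import Data.Fin using (Fin; zero; suc)
  open import Data.Product using (Σ; ∃; _×_; _,_)
  open import Data.Empty using (⊥-elim)
  open import Relation.Nullary using (Dec; yes; no; ¬?)
  open import Relation.Unary using (Pred; Decidable)
  open import Relation.Binary.PropositionalEquality

  𝟙 : {P : Set} → Dec P → ℕ
  𝟙 (yes _) = 1
  𝟙 (no _)  = 0

  𝟙-bound : ∀ {P : Set} c D (d : Dec P) → (P → c ≤ D) → c * 𝟙 d ≤ D
  𝟙-bound c D (yes p) c≤D = ≤-trans (≤-reflexive (*-identityʳ c)) (c≤D p)
  𝟙-bound c D (no _)  _   = ≤-trans (≤-reflexive (*-zeroʳ c)) z≤n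

  𝟙≤1 : {P : Set} (d : Dec P) → 𝟙 d ≤ 1
  𝟙≤1 (yes _) = s≤s z≤n
  𝟙≤1 (no _)  = z≤n

  module _ {A : Set} where

    ∑ : List A → (A → ℕ) → ℕ
    ∑ []       g = 0
    ∑ (x ∷ xs) g = g x + ∑ xs g

    syntax ∑ xs (λ x → g) = ∑[ x ← xs ] g

    ∑-cong : ∀ xs {g h : A → ℕ} → (∀ x → g x ≡ h x) → ∑ xs g ≡ ∑ xs h
    ∑-cong []       g≡h = refl
    ∑-cong (x ∷ xs) g≡h = cong₂ _+_ (g≡h x) (∑-cong xs g≡h)

    ∑-mono : ∀ xs {g h : A → ℕ} → (∀ x → g x ≤ h x) → ∑ xs g ≤ ∑ xs h
    ∑-mono []       g≤h = z≤n
    ∑-mono (x ∷ xs) g≤h = +-mono-≤ (g≤h x) (∑-mono xs g≤h)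

    ∑-const : ∀ xs k → ∑[ _ ← xs ] k ≡ length xs * k
    ∑-const []       k = refl
    ∑-const (x ∷ xs) k = cong (k +_) (∑-const xs k)

    ∑-+ : ∀ xs (g h : A → ℕ) → ∑[ x ← xs ] (g x + h x) ≡ ∑ xs g + ∑ xs h
    ∑-+ []       g h = refl
    ∑-+ (x ∷ xs) g h = begin
      g x + h x + ∑[ x ← xs ] (g x + h x) ≡⟨ cong (g x + h x +_) (∑-+ xs g h) ⟩
      g x + h x + (∑ xs g + ∑ xs h)        ≡⟨ interchange (g x) (h x) (∑ xs g) (∑ xs h) ⟩
      g x + ∑ xs g + (h x + ∑ xs h)        ∎
      where
      open ≡-Reasoning
      interchange : ∀ a b c d → a + b + (c + d) ≡ a + c + (b + d)
      interchange = solve-∀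

    ∑-* : ∀ xs k (g : A → ℕ) → ∑[ x ← xs ] (k * g x) ≡ k * ∑ xs g
    ∑-* []       k g = sym (*-zeroʳ k)
    ∑-* (x ∷ xs) k g = trans (cong (k * g x +_) (∑-* xs k g)) (sym (*-distribˡ-+ k (g x) (∑ xs g)))

    ∑-*ʳ : ∀ xs k (g : A → ℕ) → ∑[ x ← xs ] (g x * k) ≡ ∑ xs g * k
    ∑-*ʳ xs k g = trans (∑-cong xs (λ x → *-comm (g x) k)) (trans (∑-* xs k g) (*-comm k (∑ xs g)))

    ∑-++ : ∀ xs ys (g : A → ℕ) → ∑ (xs ++ ys) g ≡ ∑ xs g + ∑ ys g
    ∑-++ []       ys g = refl
    ∑-++ (x ∷ xs) ys g = trans (cong (g x +_) (∑-++ xs ys g)) (sym (+-assoc (g x) _ _))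

    ∑-scaled-bound : ∀ xs c (w D : A → ℕ) → (∀ x → c * w x ≤ D x) → c * ∑ xs w ≤ ∑ xs D
    ∑-scaled-bound xs c w D cw≤D = subst (_≤ ∑ xs D) (∑-* xs c w) (∑-mono xs cw≤D)

    length-filter : ∀ {P : Pred A _} (P? : Decidable P) xs → length (filter P? xs) ≡ ∑[ x ← xs ] 𝟙 (P? x)
    length-filter P? []       = refl
    length-filter P? (x ∷ xs) with P? x
    ... | yes _ = cong suc (length-filter P? xs)
    ... | no  _ = length-filter P? xs

    ∑-𝟙≤length : ∀ {P : Pred A _} (P? : Decidable P) xs → ∑[ x ← xs ] 𝟙 (P? x) ≤ length xs
    ∑-𝟙≤length P? xs = ≤-trans (∑-mono xs (λ x → 𝟙≤1 (P? x))) (≤-reflexive (trans (∑-const xs 1) (*-identityʳ _)))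

    ∑-𝟙-unique : ∀ {P : Pred A _} (P? : Decidable P) {xs} → Unique xs →
      (∀ {a b} → P a → P b → a ≡ b) → ∑[ x ← xs ] 𝟙 (P? x) ≤ 1
    ∑-𝟙-unique P? {[]}     []           P-unique = z≤n
    ∑-𝟙-unique P? {x ∷ xs} (x∉xs ∷ uxs) P-unique with P? x
    ... | no  _  = ∑-𝟙-unique P? uxs P-unique
    ... | yes Px = s≤s (≤-reflexive (∑-zero x∉xs))
      where
      ∑-zero : ∀ {ys} → All (x ≢_) ys → ∑[ y ← ys ] 𝟙 (P? y) ≡ 0
      ∑-zero []             = refl
      ∑-zero {y ∷ _} (x≢y ∷ rest) with P? y
      ... | yes Py = ⊥-elim (x≢y (P-unique Px Py))
      ... | no  _  = ∑-zero rest

    ∑-𝟙-witness : ∀ {P : Pred A _} (P? : Decidable P) {xs x} → x ∈ xs → P x → 1 ≤ ∑[ y ← xs ] 𝟙 (P? y)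
    ∑-𝟙-witness P? {x ∷ xs} (here refl) Px with P? x
    ... | yes _  = s≤s z≤n
    ... | no ¬Px = ⊥-elim (¬Px Px)
    ∑-𝟙-witness P? {y ∷ xs} (there x∈xs) Px = ≤-trans (∑-𝟙-witness P? x∈xs Px) (m≤n+m _ (𝟙 (P? y)))

    ∑-partition : ∀ {P : Pred A _} (P? : Decidable P) xs (g : A → ℕ) →
      ∑[ x ← xs ] (g x * 𝟙 (P? x)) + ∑[ x ← xs ] (g x * 𝟙 (¬? (P? x))) ≡ ∑ xs g
    ∑-partition P? xs g = trans (sym (∑-+ xs _ _)) (∑-cong xs (λ x → split (g x) (P? x)))
      where
      split : ∀ a {P : Set} (d : Dec P) → a * 𝟙 d + a * 𝟙 (¬? d) ≡ a
      split a (yes _) = trans (cong (_+ a * 0) (*-identityʳ a)) (trans (cong (a +_) (*-zeroʳ a)) (+-identityʳ a))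
      split a (no _)  = trans (cong (_+ a * 1) (*-zeroʳ a)) (*-identityʳ a)

    ∑-𝟙-partition : ∀ {P : Pred A _} (P? : Decidable P) xs →
      ∑[ x ← xs ] 𝟙 (P? x) + ∑[ x ← xs ] 𝟙 (¬? (P? x)) ≡ length xs
    ∑-𝟙-partition P? xs = trans (sym (∑-+ xs _ _)) (trans (∑-cong xs (λ x → split (P? x)))
                                  (trans (∑-const xs 1) (*-identityʳ _)))
      where
      split : {P : Set} (d : Dec P) → 𝟙 d + 𝟙 (¬? d) ≡ 1
      split (yes _) = refl
      split (no _)  = refl

    averaging : ∀ b (g : A → ℕ) xs → 0 < length xs → length xs * b ≤ ∑ xs g → ∃ λ z → z ∈ xs × b ≤ g z
    averaging b g xs@(_ ∷ _) _ avg≤∑ with All.all? (λ x → g x <? b) xs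
    ... | yes all< = ⊥-elim (<⇒≱ (∑-below all<) avg≤∑)
      where
      ∑-below : ∀ {y ys} → All (λ x → g x < b) (y ∷ ys) → ∑ (y ∷ ys) g < length (y ∷ ys) * b
      ∑-below (gy<b ∷ rest) = +-mono-<-≤ gy<b (∑-≤ rest)
        where
        ∑-≤ : ∀ {ys} → All (λ x → g x < b) ys → ∑ ys g ≤ length ys * b
        ∑-≤ []           = z≤n
        ∑-≤ (gy<b ∷ rest) = +-mono-≤ (<⇒≤ gy<b) (∑-≤ rest)
    ... | no ¬all< with find (¬All⇒Any¬ (λ x → g x <? b) xs ¬all<)
    ...   | z , z∈xs , ¬gz<b = z , z∈xs , ≮⇒≥ ¬gz<b

  ∑-swap : ∀ {A B : Set} (xs : List A) (ys : List B) (g : A → B → ℕ) →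
    ∑[ x ← xs ] ∑[ y ← ys ] g x y ≡ ∑[ y ← ys ] ∑[ x ← xs ] g x y
  ∑-swap []       ys g = sym (trans (∑-const ys 0) (*-zeroʳ (length ys)))
  ∑-swap (x ∷ xs) ys g = trans (cong (∑ ys (g x) +_) (∑-swap xs ys g)) (sym (∑-+ ys (g x) _))

  ∑-map : ∀ {A B : Set} (h : A → B) (xs : List A) (g : B → ℕ) → ∑ (map h xs) g ≡ ∑[ x ← xs ] g (h x)
  ∑-map h []       g = refl
  ∑-map h (x ∷ xs) g = cong (g (h x) +_) (∑-map h xs g)

  ∑-cartesian : ∀ {A B : Set} (xs : List A) (ys : List B) (g : A × B → ℕ) →
    ∑ (cartesianProduct xs ys) g ≡ ∑[ x ← xs ] ∑[ y ← ys ] g (x , y)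
  ∑-cartesian []       ys g = refl
  ∑-cartesian (x ∷ xs) ys g =
    trans (∑-++ (map (x ,_) ys) _ g) (cong₂ _+_ (∑-map (x ,_) ys g) (∑-cartesian xs ys g))

  module _ {A : Set} (_≟_ : (a b : A) → Dec (a ≡ b)) where
    ∑-delta : ∀ {xs} → Unique xs → ∀ {i} → i ∈ xs → (h : A → ℕ) → ∑[ c ← xs ] (𝟙 (i ≟ c) * h c) ≡ h i
    ∑-delta {x ∷ xs} (x∉xs ∷ _) (here refl) h with x ≟ x
    ... | no x≢x = ⊥-elim (x≢x refl)
    ... | yes _  = trans (cong₂ _+_ (+-identityʳ (h x)) (∑-vanish x∉xs)) (+-identityʳ (h x))
      where
      ∑-vanish : ∀ {ys} → All (x ≢_) ys → ∑[ c ← ys ] (𝟙 (x ≟ c) * h c) ≡ 0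
      ∑-vanish []                = refl
      ∑-vanish {y ∷ _} (x≢y ∷ rest) with x ≟ y
      ... | yes x≡y = ⊥-elim (x≢y x≡y)
      ... | no  _   = ∑-vanish rest
    ∑-delta {x ∷ xs} (x∉xs ∷ uxs) {i} (there i∈xs) h with i ≟ x
    ... | yes refl = ⊥-elim (All.lookup x∉xs i∈xs refl)
    ... | no  _    = ∑-delta uxs i∈xs h

  AllPairs-lookup : ∀ {A : Set} {R : A → A → Set} {xs} → (∀ {a b} → R a b → R b a) → AllPairs R xs →
    ∀ {i j : Fin (length xs)} → i ≢ j → R (lookup xs i) (lookup xs j)
  AllPairs-lookup sym-R (Rx ∷ _)  {zero}  {zero}  i≢j = ⊥-elim (i≢j refl)
  AllPairs-lookup sym-R (Rx ∷ _)  {zero}  {suc j} i≢j = All.lookup Rx (∈-lookup j)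
  AllPairs-lookup sym-R (Rx ∷ _)  {suc i} {zero}  i≢j = sym-R (All.lookup Rx (∈-lookup i))
  AllPairs-lookup sym-R (_ ∷ Rxs) {suc i} {suc j} i≢j = AllPairs-lookup sym-R Rxs (λ i≡j → i≢j (cong suc i≡j))

  two-distinct : ∀ {A : Set} {ys : List A} → Unique ys → 2 ≤ length ys → Σ A λ x → Σ A λ y → x ∈ ys × y ∈ ys × x ≢ y
  two-distinct {ys = x ∷ y ∷ _} ((x≢y ∷ _) ∷ _) _ = x , y , here refl , there (here refl) , x≢y
  two-distinct {ys = _ ∷ []} _ (s≤s ())

module Deviation where
  open import Data.Nat
  open import Data.Nat.Properties
  open import Data.Nat.Tactic.RingSolver using (solve-∀)
  open import Data.Product using (_×_; _,_)
  open import Data.Sum using (inj₁; inj₂)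
  open import Relation.Nullary using (¬_; Dec; yes; no; contradiction)
  open import Relation.Nullary.Decidable using (_×-dec_)
  open import Relation.Binary.PropositionalEquality
  open import Data.List using (List; length)
  open FiniteSums

  -- ∣ u - N ∣² = u² + N² - 2uN, stated without subtraction.
  ∣-∣²-identity : ∀ u N → ∣ u - N ∣ * ∣ u - N ∣ + 2 * u * N ≡ u * u + N * N
  ∣-∣²-identity u N with ≤-total u N
  ... | inj₁ u≤N with m≤n⇒∃[o]m+o≡n u≤N
  ...   | w , refl = trans (cong (λ d → d * d + 2 * u * (u + w)) (∣m-m+n∣≡n u w)) (square u w)
    where
    square : ∀ u w → w * w + 2 * u * (u + w) ≡ u * u + (u + w) * (u + w)
    square = solve-∀
  ∣-∣²-identity u N | inj₂ N≤u with m≤n⇒∃[o]m+o≡n N≤u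
  ...   | w , refl = trans (cong (λ d → d * d + 2 * (N + w) * N) (trans (∣-∣-comm (N + w) N) (∣m-m+n∣≡n N w))) (square N w)
    where
    square : ∀ N w → w * w + 2 * (N + w) * N ≡ (N + w) * (N + w) + N * N
    square = solve-∀

  gap-below : ∀ u N {e} → u + e ≤ N → e ≤ ∣ u - N ∣
  gap-below u N u+e≤N = +-cancelˡ-≤ u _ _ (≤-trans u+e≤N (m≤n+∣n-m∣ N u))

  gap-above : ∀ u N {e} → N + e ≤ u → e ≤ ∣ u - N ∣
  gap-above u N N+e≤u = +-cancelˡ-≤ N _ _ (≤-trans N+e≤u (m≤n+∣m-n∣ u N))

  scaled-gap-below : ∀ k u N {e} → k * u + e ≤ k * N → e ≤ k * ∣ u - N ∣
  scaled-gap-below k u N gap = subst (_ ≤_) (sym (*-distribˡ-∣-∣ k u N)) (gap-below (k * u) (k * N) gap)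

  scaled-gap-above : ∀ k u N {e} → k * N + e ≤ k * u → e ≤ k * ∣ u - N ∣
  scaled-gap-above k u N gap = subst (_ ≤_) (sym (*-distribˡ-∣-∣ k u N)) (gap-above (k * u) (k * N) gap)

  product-bound : ∀ {u N} d α β → u ≤ α * d → N ≤ β * d → u * N ≤ (α * β) * (d * d)
  product-bound d α β u≤ N≤ = ≤-trans (*-mono-≤ u≤ N≤) (≤-reflexive (regroup α β d))
    where
    regroup : ∀ α β d → α * d * (β * d) ≡ α * β * (d * d)
    regroup = solve-∀

  double : ∀ n → 2 * n ≡ n + n
  double n = cong (n +_) (+-identityʳ n)

  -- A line through a point z carrying a points of E (so k = a - 1 others) is
  -- balanced when N/(2q) ≤ k < 2N/q, where N/q is the average per line.
  Balanced : ℕ → ℕ → ℕ → Set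
  Balanced q N k = N ≤ 2 * q * k × q * k < 2 * N

  balanced? : ∀ q N k → Dec (Balanced q N k)
  balanced? q N k = (N ≤? 2 * q * k) ×-dec (q * k <? 2 * N)

  sparse-deviation : ∀ {q N a} → a ≤ 1 → 2 * q ≤ N → N * N ≤ 4 * (∣ q * a - N ∣ * ∣ q * a - N ∣)
  sparse-deviation {q} {N} {a} a≤1 2q≤N = product-bound ∣ q * a - N ∣ 2 2 N≤2d N≤2d
    where
    open ≤-Reasoning
    N≤2d : N ≤ 2 * ∣ q * a - N ∣
    N≤2d = scaled-gap-below 2 (q * a) N (begin
      2 * (q * a) + N ≤⟨ +-monoˡ-≤ N (*-monoʳ-≤ 2 (≤-trans (*-monoʳ-≤ q a≤1) (≤-reflexive (*-identityʳ q)))) ⟩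
      2 * q + N       ≤⟨ +-monoˡ-≤ N 2q≤N ⟩
      N + N           ≡⟨ double N ⟨
      2 * N           ∎)

  unbalanced-deviation : ∀ {q N a} → 4 * q ≤ N → ¬ Balanced q N (a ∸ 1) →
    q * a * N ≤ 16 * (∣ q * a - N ∣ * ∣ q * a - N ∣)
  unbalanced-deviation {q} {N} {zero} _ _ = ≤-trans (≤-reflexive (cong (_* N) (*-zeroʳ q))) z≤n
  unbalanced-deviation {q} {N} {suc k} 4q≤N ¬balanced with N ≤? 2 * q * k | q * k <? 2 * N
  ... | yes N≤2qk | yes qk<2N = contradiction (N≤2qk , qk<2N) ¬balanced
  ... | no N≰2qk  | _         = product-bound ∣ u - N ∣ 4 4 (≤-trans u≤N N≤4d) N≤4d
    where
    open ≤-Reasoning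
    u = q * suc k
    expand : ∀ q k N → 4 * (q * suc k) + N ≡ 4 * q + 2 * (2 * q * k) + N
    expand = solve-∀
    four : ∀ N → N + 2 * N + N ≡ 4 * N
    four = solve-∀
    4u+N≤4N : 4 * u + N ≤ 4 * N
    4u+N≤4N = begin
      4 * u + N                   ≡⟨ expand q k N ⟩
      4 * q + 2 * (2 * q * k) + N ≤⟨ +-monoˡ-≤ N (+-mono-≤ 4q≤N (*-monoʳ-≤ 2 (<⇒≤ (≰⇒> N≰2qk)))) ⟩
      N + 2 * N + N               ≡⟨ four N ⟩
      4 * N                       ∎
    N≤4d : N ≤ 4 * ∣ u - N ∣
    N≤4d = scaled-gap-below 4 u N 4u+N≤4N
    u≤N : u ≤ N
    u≤N = *-cancelˡ-≤ 4 (≤-trans (m≤m+n (4 * u) N) 4u+N≤4N)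
  ... | yes _     | no qk≮2N  = product-bound ∣ u - N ∣ 2 8 u≤2d (≤-trans N≤d (m≤n*m _ 8))
    where
    open ≤-Reasoning
    u = q * suc k
    2N≤u : 2 * N ≤ u
    2N≤u = ≤-trans (≮⇒≥ qk≮2N) (≤-trans (m≤n+m (q * k) q) (≤-reflexive (sym (*-suc q k))))
    N≤d : N ≤ ∣ u - N ∣
    N≤d = gap-above u N (≤-trans (≤-reflexive (sym (double N))) 2N≤u)
    u≤2d : u ≤ 2 * ∣ u - N ∣
    u≤2d = scaled-gap-above 2 u N (begin
      2 * N + u ≤⟨ +-monoˡ-≤ u 2N≤u ⟩
      u + u     ≡⟨ double u ⟨
      2 * u     ∎)

  variance-bound : ∀ {A : Set} (xs : List A) (a : A → ℕ) q N →
    length xs ≡ suc q * q → ∑ xs a ≡ suc q * N → ∑[ x ← xs ] (a x * a x) ≤ N * (N + q) →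
    ∑[ x ← xs ] (∣ q * a x - N ∣ * ∣ q * a x - N ∣) ≤ q * q * q * N
  variance-bound xs a q N length≡ mass≡ moment≤ = +-cancelʳ-≤ T _ _ (begin
    ∑ xs D + T                                      ≡⟨ cong (λ m → ∑ xs D + 2 * q * N * m) mass≡ ⟨
    ∑ xs D + 2 * q * N * ∑ xs a                     ≡⟨ summed-identity ⟩
    q * q * ∑[ x ← xs ] (a x * a x) + length xs * (N * N)
      ≤⟨ +-mono-≤ (*-monoʳ-≤ (q * q) moment≤) (≤-reflexive (cong (_* (N * N)) length≡)) ⟩
    q * q * (N * (N + q)) + suc q * q * (N * N)     ≤⟨ m≤m+n _ (q * N * N) ⟩
    q * q * (N * (N + q)) + suc q * q * (N * N) + q * N * N ≡⟨ expand q N ⟩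
    q * q * q * N + T                               ∎)
    where
    open ≤-Reasoning
    D : _ → ℕ
    D x = ∣ q * a x - N ∣ * ∣ q * a x - N ∣
    T : ℕ
    T = 2 * q * N * (suc q * N)
    expand : ∀ q N → q * q * (N * (N + q)) + suc q * q * (N * N) + q * N * N ≡ q * q * q * N + 2 * q * N * (suc q * N)
    expand = solve-∀
    pointwise : ∀ x → D x + 2 * q * N * a x ≡ q * q * (a x * a x) + N * N
    pointwise x = trans (cong (D x +_) (regroup₁ q N (a x)))
                    (trans (∣-∣²-identity (q * a x) N) (cong (_+ N * N) (regroup₂ q (a x))))
      where
      regroup₁ : ∀ q N a → 2 * q * N * a ≡ 2 * (q * a) * N
      regroup₁ = solve-∀
      regroup₂ : ∀ q a → q * a * (q * a) ≡ q * q * (a * a)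
      regroup₂ = solve-∀
    summed-identity : ∑ xs D + 2 * q * N * ∑ xs a ≡ q * q * ∑[ x ← xs ] (a x * a x) + length xs * (N * N)
    summed-identity = begin-equality
      ∑ xs D + 2 * q * N * ∑ xs a                         ≡⟨ cong (∑ xs D +_) (∑-* xs (2 * q * N) a) ⟨
      ∑ xs D + ∑[ x ← xs ] (2 * q * N * a x)              ≡⟨ ∑-+ xs D _ ⟨
      ∑[ x ← xs ] (D x + 2 * q * N * a x)                 ≡⟨ ∑-cong xs pointwise ⟩
      ∑[ x ← xs ] (q * q * (a x * a x) + N * N)           ≡⟨ ∑-+ xs _ _ ⟩
      ∑[ x ← xs ] (q * q * (a x * a x)) + ∑[ _ ← xs ] (N * N)
                                  ≡⟨ cong₂ _+_ (∑-* xs (q * q) (λ x → a x * a x)) (∑-const xs (N * N)) ⟩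
      q * q * ∑[ x ← xs ] (a x * a x) + length xs * (N * N) ∎

-- The q + 1 directions are indexed by
-- Fin (1 + q): zero is the vertical direction (0,1) and suc t the direction
-- (1,t) of slope t. The q parallel lines of a direction are the level sets
-- of a linear form, so every line is lineAt d c for a direction d and a
-- level c, and different parameters give different lines.
module LineCoordinates {q : ℕ} (F : FieldOn q) where
  open import Data.Fin using (Fin; zero; suc; _≟_)
  open import Data.Product using (_,_; proj₁; proj₂)
  open import Data.Empty using (⊥; ⊥-elim)
  open import Relation.Nullary using (yes; no)
  open import Relation.Binary.PropositionalEquality
  open import Algebra.Bundles using (CommutativeRing; Ring)
  open import Function.Bundles using (Equivalence)
  open FieldOn F using (isCommutativeRing; 0≢1; inverse)
  open Plane F

  fieldRing : CommutativeRing _ _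
  fieldRing = record { isCommutativeRing = isCommutativeRing }

  open CommutativeRing fieldRing using (_+_; _*_; -_; _-_; 0#; 1#; +-comm; +-assoc; *-comm; *-assoc;
    +-identityˡ; +-identityʳ; *-identityˡ; *-identityʳ; zeroʳ; +-abelianGroup; +-group; ring)
  open import Algebra.Properties.Group +-group using (//-rightDividesˡ; //-rightDividesʳ; x∙y⁻¹≈ε⇒x≈y)
  open import Algebra.Properties.AbelianGroup +-abelianGroup using (xyx⁻¹≈y)
  open import Algebra.Properties.RingWithoutOne (Ring.ringWithoutOne ring) using ([y-z]x≈yx-zx)
  open ≡-Reasoning

  Direction : Set
  Direction = Fin (ℕ.suc q)

  level : Direction → Point → Fin q
  level zero    (x , y) = x
  level (suc t) (x , y) = y - x * t

  direction : Direction → Point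
  direction zero    = (0# , 1#)
  direction (suc t) = (1# , t)

  direction≢0 : ∀ d → direction d ≢ origin
  direction≢0 zero    e = 0≢1 (sym (cong proj₂ e))
  direction≢0 (suc t) e = 0≢1 (sym (cong proj₁ e))

  anchor : Direction → Fin q → Point
  anchor zero    c = (c , 0#)
  anchor (suc t) c = (0# , c)

  lineAt : Direction → Fin q → Line
  lineAt d c = line (anchor d c) (direction d) (direction≢0 d)

  pointAt : Direction → Fin q → Fin q → Point
  pointAt d c s = anchor d c ⊕ (s · direction d)

  c+s0≡c : ∀ c s → c + s * 0# ≡ c
  c+s0≡c c s = trans (cong (c +_) (zeroʳ s)) (+-identityʳ c)

  0+s1≡s : ∀ s → 0# + s * 1# ≡ s
  0+s1≡s s = trans (+-identityˡ _) (*-identityʳ s)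

  on-line⇒level : ∀ d c p → p ∈L lineAt d c → level d p ≡ c
  on-line⇒level zero    c _ (s , refl) = c+s0≡c c s
  on-line⇒level (suc t) c _ (s , refl) = begin
    c + s * t - (0# + s * 1#) * t ≡⟨ cong (λ x → c + s * t - x * t) (0+s1≡s s) ⟩
    c + s * t - s * t             ≡⟨ //-rightDividesʳ (s * t) c ⟩
    c                             ∎

  level⇒on-line : ∀ d c p → level d p ≡ c → p ∈L lineAt d c
  level⇒on-line zero    _ (x , y) refl = y , cong₂ _,_ (sym (c+s0≡c x y)) (sym (0+s1≡s y))
  level⇒on-line (suc t) _ (x , y) refl = x , cong₂ _,_ (sym (0+s1≡s x)) (sym (//-rightDividesˡ (x * t) y))

  pointAt-on-line : ∀ d c s → pointAt d c s ∈L lineAt d c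
  pointAt-on-line d c s = s , refl

  pointAt-0≢1 : ∀ d c → pointAt d c 0# ≢ pointAt d c 1#
  pointAt-0≢1 zero    c e = 0≢1 (trans (sym (0+s1≡s 0#)) (trans (cong proj₂ e) (0+s1≡s 1#)))
  pointAt-0≢1 (suc t) c e = 0≢1 (trans (sym (0+s1≡s 0#)) (trans (cong proj₁ e) (0+s1≡s 1#)))

  equal-slope-levels : ∀ x y x' y' t → y - x * t ≡ y' - x' * t → y - y' ≡ (x - x') * t
  equal-slope-levels x y x' y' t e = begin
    y - y'                                  ≡⟨ cong (_- y') (sym (//-rightDividesˡ (x * t) y)) ⟩
    y - x * t + x * t - y'                  ≡⟨ cong (λ z → z + x * t - y') e ⟩
    y' - x' * t + x * t - y'                ≡⟨ cong (_- y') (+-assoc y' (- (x' * t)) (x * t)) ⟩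
    y' + (- (x' * t) + x * t) - y'          ≡⟨ xyx⁻¹≈y y' (- (x' * t) + x * t) ⟩
    - (x' * t) + x * t                      ≡⟨ +-comm (- (x' * t)) (x * t) ⟩
    x * t - x' * t                          ≡⟨ sym ([y-z]x≈yx-zx t x x') ⟩
    (x - x') * t                            ∎

  *-cancelˡ : ∀ a t t' → a ≢ 0# → a * t ≡ a * t' → t ≡ t'
  *-cancelˡ a t t' a≢0 e with inverse a a≢0
  ... | b , ab≡1 = begin
    t             ≡⟨ sym (*-identityˡ t) ⟩
    1# * t        ≡⟨ cong (_* t) (sym ab≡1) ⟩
    a * b * t     ≡⟨ reassoc t ⟩
    b * (a * t)   ≡⟨ cong (b *_) e ⟩
    b * (a * t')  ≡⟨ sym (reassoc t') ⟩
    a * b * t'    ≡⟨ cong (_* t') ab≡1 ⟩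
    1# * t'       ≡⟨ *-identityˡ t' ⟩
    t'            ∎
    where
    reassoc : ∀ u → a * b * u ≡ b * (a * u)
    reassoc u = trans (cong (_* u) (*-comm a b)) (*-assoc b a u)

  common-direction-unique : ∀ {p p'} → p ≢ p' → ∀ d d' →
    level d p ≡ level d p' → level d' p ≡ level d' p' → d ≡ d'
  common-direction-unique {x , y} {x' , y'} p≢p' d d' = shared d d'
    where
    vertical-pair : x ≡ x' → ∀ t → y - x * t ≡ y' - x' * t → ⊥
    vertical-pair refl t e = p≢p' (cong (x ,_) (trans (sym (//-rightDividesˡ (x * t) y))
                               (trans (cong (_+ x * t) e) (//-rightDividesˡ (x * t) y'))))
    shared : ∀ d d' → level d (x , y) ≡ level d (x' , y') → level d' (x , y) ≡ level d' (x' , y') → d ≡ d'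
    shared zero    zero     _  _  = refl
    shared zero    (suc t') e₁ e₂ = ⊥-elim (vertical-pair e₁ t' e₂)
    shared (suc t) zero     e₁ e₂ = ⊥-elim (vertical-pair e₂ t e₁)
    shared (suc t) (suc t') e₁ e₂ with x ≟ x'
    ... | yes x≡x' = ⊥-elim (vertical-pair x≡x' t e₁)
    ... | no  x≢x' = cong suc (*-cancelˡ (x - x') t t' (λ e → x≢x' (x∙y⁻¹≈ε⇒x≈y x x' e))
                       (trans (sym (equal-slope-levels x y x' y' t e₁)) (equal-slope-levels x y x' y' t' e₂)))

  lineAt-injective : ∀ {d c d' c'} → SameLine (lineAt d c) (lineAt d' c') → (d , c) ≡ (d' , c')
  lineAt-injective {d} {c} {d'} {c'} same = cong₂ _,_ d≡d' (trans (sym (level-of p₀ on₀)) (trans (cong (λ e → level e p₀) d≡d') (level-of' p₀ on₀')))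
    where
    p₀ = pointAt d c 0#
    p₁ = pointAt d c 1#
    on₀ = pointAt-on-line d c 0#
    on₁ = pointAt-on-line d c 1#
    on₀' = Equivalence.to (same p₀) on₀
    on₁' = Equivalence.to (same p₁) on₁
    level-of = on-line⇒level d c
    level-of' = on-line⇒level d' c'
    d≡d' : d ≡ d'
    d≡d' = common-direction-unique (pointAt-0≢1 d c) d d'
             (trans (level-of p₀ on₀) (sym (level-of p₁ on₁)))
             (trans (level-of' p₀ on₀') (sym (level-of' p₁ on₁')))

module Incidences {q : ℕ} (F : FieldOn q) (E : List (Plane.Point F)) (E-unique : Unique E) where
  open import Data.Nat
  open import Data.Nat.Properties
  open import Data.Nat.Tactic.RingSolver using (solve-∀)
  open import Data.Fin using (Fin) renaming (_≟_ to _≟ᶠ_)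
  open import Data.Product using (Σ; _×_; _,_; proj₁; proj₂)
  import Data.Product.Properties as Product
  open import Data.List using (List; length; filter; map; cartesianProduct; allFin)
  open import Data.List.Properties using (length-map; length-tabulate)
  open import Data.List.Relation.Unary.All as All using (All)
  import Data.List.Relation.Unary.All.Properties as All
  open import Data.List.Relation.Unary.AllPairs as AllPairs using (AllPairs)
  import Data.List.Relation.Unary.AllPairs.Properties as AllPairs
  import Data.List.Relation.Unary.Unique.Propositional.Properties as Unique
  open import Data.List.Membership.Propositional using (_∈_)
  open import Data.List.Membership.Propositional.Properties using (∈-filter⁺; ∈-filter⁻; ∈-allFin)
  open import Data.Empty using (⊥-elim)
  open import Relation.Nullary using (¬_; Dec; yes; no; ¬?)
  open import Relation.Nullary.Decidable using (_×-dec_)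
  open import Relation.Binary.PropositionalEquality
  open import Function.Bundles using (mk⇔)
  open import Function.Construct.Symmetry using (⇔-sym)
  open Plane F
  open LineCoordinates F
  open FiniteSums
  open Deviation

  N : ℕ
  N = length E

  _≟ₚ_ : (p p' : Point) → Dec (p ≡ p')
  _≟ₚ_ = Product.≡-dec _≟ᶠ_ _≟ᶠ_

  directions : List Direction
  directions = allFin (suc q)

  levels : List (Fin q)
  levels = allFin q

  Cell : Set
  Cell = Direction × Fin q

  cells : List Cell
  cells = cartesianProduct directions levels

  lineOf : Cell → Line
  lineOf (d , c) = lineAt d c

  -- Decides whether p lies on lineAt d c (by on-line⇒level and level⇒on-line).
  on-line? : ∀ d c (p : Point) → Dec (level d p ≡ c)
  on-line? d c p = level d p ≟ᶠ c

  count : Direction → Fin q → ℕ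
  count d c = ∑[ p ← E ] 𝟙 (on-line? d c p)

  countOf : Cell → ℕ
  countOf (d , c) = count d c

  length-allFin : ∀ n → length (allFin n) ≡ n
  length-allFin n = length-tabulate (λ i → i)

  fiber-sum : ∀ d (h : Fin q → ℕ) → ∑[ c ← levels ] (count d c * h c) ≡ ∑[ p ← E ] h (level d p)
  fiber-sum d h = begin
    ∑[ c ← levels ] (count d c * h c)                            ≡⟨ ∑-cong levels (λ c → ∑-*ʳ E (h c) _) ⟨
    ∑[ c ← levels ] ∑[ p ← E ] (𝟙 (level d p ≟ᶠ c) * h c)        ≡⟨ ∑-swap levels E _ ⟩
    ∑[ p ← E ] ∑[ c ← levels ] (𝟙 (level d p ≟ᶠ c) * h c)        ≡⟨ ∑-cong E (λ p → ∑-delta _≟ᶠ_ (Unique.allFin⁺ q) (∈-allFin (level d p)) h) ⟩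
    ∑[ p ← E ] h (level d p)                                     ∎
    where open ≡-Reasoning

  ∑-cells : ∀ (g : Cell → ℕ) → ∑ cells g ≡ ∑[ d ← directions ] ∑[ c ← levels ] g (d , c)
  ∑-cells = ∑-cartesian directions levels

  cell-count : length cells ≡ suc q * q
  cell-count = begin
    length cells                                ≡⟨ trans (∑-const cells 1) (*-identityʳ _) ⟨
    ∑[ _ ← cells ] 1                            ≡⟨ ∑-cells (λ _ → 1) ⟩
    ∑[ _ ← directions ] ∑[ _ ← levels ] 1       ≡⟨ ∑-cong directions (λ _ → trans (∑-const levels 1) (trans (*-identityʳ _) (length-allFin q))) ⟩
    ∑[ _ ← directions ] q                       ≡⟨ trans (∑-const directions q) (cong (_* q) (length-allFin (suc q))) ⟩
    suc q * q                                   ∎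
    where open ≡-Reasoning

  -- First moment: each direction partitions the plane, so every point
  -- lies on exactly q + 1 of the lines.
  first-moment : ∑ cells countOf ≡ suc q * N
  first-moment = begin
    ∑ cells countOf                                     ≡⟨ ∑-cells countOf ⟩
    ∑[ d ← directions ] ∑[ c ← levels ] count d c       ≡⟨ ∑-cong directions (λ d → ∑-cong levels (λ c → *-identityʳ (count d c))) ⟨
    ∑[ d ← directions ] ∑[ c ← levels ] (count d c * 1) ≡⟨ ∑-cong directions (λ d → fiber-sum d (λ _ → 1)) ⟩
    ∑[ _ ← directions ] ∑[ _ ← E ] 1                    ≡⟨ ∑-cong directions (λ _ → trans (∑-const E 1) (*-identityʳ N)) ⟩
    ∑[ _ ← directions ] N                               ≡⟨ trans (∑-const directions N) (cong (_* N) (length-allFin (suc q))) ⟩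
    suc q * N                                           ∎
    where open ≡-Reasoning

  common-lines : ∀ y z → ∑[ d ← directions ] 𝟙 (level d y ≟ᶠ level d z) ≤ 1 + q * 𝟙 (y ≟ₚ z)
  common-lines y z with y ≟ₚ z
  ... | yes refl = ≤-trans (∑-𝟙≤length (λ d → level d y ≟ᶠ level d y) directions)
                     (≤-reflexive (trans (length-allFin (suc q)) (cong suc (sym (*-identityʳ q)))))
  ... | no y≢z   = ≤-trans (∑-𝟙-unique (λ d → level d y ≟ᶠ level d z) (Unique.allFin⁺ (suc q))
                              (common-direction-unique y≢z _ _))
                     (m≤m+n 1 (q * 0))

  multiplicity≤1 : ∀ z → ∑[ y ← E ] 𝟙 (y ≟ₚ z) ≤ 1
  multiplicity≤1 z = ∑-𝟙-unique (_≟ₚ z) E-unique (λ y≡z y'≡z → trans y≡z (sym y'≡z))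

  -- Second moment: the sum of count² counts pairs of points of E on a
  -- common line; distinct pairs contribute at most 1, equal pairs q + 1.
  second-moment : ∑[ x ← cells ] (countOf x * countOf x) ≤ N * (N + q)
  second-moment = begin
    ∑[ x ← cells ] (countOf x * countOf x)                              ≡⟨ ∑-cells _ ⟩
    ∑[ d ← directions ] ∑[ c ← levels ] (count d c * count d c)         ≡⟨ ∑-cong directions (λ d → fiber-sum d (count d)) ⟩
    ∑[ d ← directions ] ∑[ z ← E ] ∑[ y ← E ] 𝟙 (level d y ≟ᶠ level d z) ≡⟨ ∑-swap directions E _ ⟩
    ∑[ z ← E ] ∑[ d ← directions ] ∑[ y ← E ] 𝟙 (level d y ≟ᶠ level d z) ≡⟨ ∑-cong E (λ z → ∑-swap directions E _) ⟩
    ∑[ z ← E ] ∑[ y ← E ] ∑[ d ← directions ] 𝟙 (level d y ≟ᶠ level d z) ≤⟨ ∑-mono E (λ z → ∑-mono E (λ y → common-lines y z)) ⟩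
    ∑[ z ← E ] ∑[ y ← E ] (1 + q * 𝟙 (y ≟ₚ z))                         ≡⟨ ∑-cong E (λ z → trans (∑-+ E _ _) (cong₂ _+_ (trans (∑-const E 1) (*-identityʳ N)) (∑-* E q _))) ⟩
    ∑[ z ← E ] (N + q * ∑[ y ← E ] 𝟙 (y ≟ₚ z))                         ≤⟨ ∑-mono E (λ z → +-monoʳ-≤ N (*-monoʳ-≤ q (multiplicity≤1 z))) ⟩
    ∑[ _ ← E ] (N + q * 1)                                             ≡⟨ trans (∑-const E _) (cong (λ t → N * (N + t)) (*-identityʳ q)) ⟩
    N * (N + q)                                                        ∎
    where open ≤-Reasoning

  deviation : Cell → ℕ
  deviation x = ∣ q * countOf x - N ∣ * ∣ q * countOf x - N ∣

  deviation-bound : ∑ cells deviation ≤ q * q * q * N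
  deviation-bound = variance-bound cells countOf q N cell-count first-moment second-moment

  ¬SameLine-sym : ∀ {L M} → ¬ SameLine L M → ¬ SameLine M L
  ¬SameLine-sym ¬same same = ¬same (λ p → ⇔-sym (same p))

  distinct-lines : ∀ {A : Set} (g : A → Cell) {xs} → AllPairs (λ a b → g a ≢ g b) xs →
    PairwiseDistinct (map (λ a → lineOf (g a)) xs)
  distinct-lines g distinct =
    AllPairs-lookup {R = λ L M → ¬ SameLine L M} (λ {L} {M} → ¬SameLine-sym {L} {M})
      (AllPairs.map⁺ (AllPairs.map (λ ga≢gb same → ga≢gb (lineAt-injective same)) distinct))

  rich-generated : ∀ d c → 2 ≤ count d c → GeneratedBy E (lineAt d c)
  rich-generated d c 2≤count
    with two-distinct (Unique.filter⁺ (on-line? d c) E-unique) (subst (2 ≤_) (sym (length-filter (on-line? d c) E)) 2≤count)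
  ... | x , y , x∈ , y∈ , x≢y with ∈-filter⁻ (on-line? d c) {xs = E} x∈ | ∈-filter⁻ (on-line? d c) {xs = E} y∈
  ...   | x∈E , x-level | y∈E , y-level =
    x , y , x∈E , y∈E , x≢y , level⇒on-line d c x x-level , level⇒on-line d c y y-level

  other? : ∀ z d (p : Point) → Dec (level d p ≡ level d z × p ≢ z)
  other? z d p = on-line? d (level d z) p ×-dec ¬? (p ≟ₚ z)

  others : Point → Direction → List Point
  others z d = filter (other? z d) E

  count-through : ∀ {z} → z ∈ E → ∀ d → count d (level d z) ≡ suc (length (others z d))
  count-through {z} z∈E d = begin
    count d (level d z)                                          ≡⟨ ∑-cong E split ⟩
    ∑[ p ← E ] (𝟙 (other? z d p) + 𝟙 (p ≟ₚ z))                   ≡⟨ ∑-+ E _ _ ⟩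
    ∑[ p ← E ] 𝟙 (other? z d p) + ∑[ p ← E ] 𝟙 (p ≟ₚ z)          ≡⟨ cong₂ _+_ (length-filter (other? z d) E) (sym z-once) ⟨
    length (others z d) + 1                                      ≡⟨ +-comm _ 1 ⟩
    suc (length (others z d))                                    ∎
    where
    open ≡-Reasoning
    split : ∀ p → 𝟙 (on-line? d (level d z) p) ≡ 𝟙 (other? z d p) + 𝟙 (p ≟ₚ z)
    split p with p ≟ₚ z | on-line? d (level d z) p
    ... | yes refl | yes _      = refl
    ... | yes refl | no  ¬level = ⊥-elim (¬level refl)
    ... | no  _    | yes _      = refl
    ... | no  _    | no  _      = refl
    z-once : ∑[ p ← E ] 𝟙 (p ≟ₚ z) ≡ 1
    z-once = ≤-antisym (multiplicity≤1 z) (∑-𝟙-witness (_≟ₚ z) z∈E refl)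

  others-count : ∀ {z} → z ∈ E → ∀ d → CountOn E z (lineAt d (level d z)) (count d (level d z) ∸ 1)
  others-count {z} z∈E d =
    others z d , Unique.filter⁺ (other? z d) E-unique , (λ p → mk⇔ (to p) (from p)) , cong (_∸ 1) (sym (count-through z∈E d))
    where
    to : ∀ p → p ∈ others z d → p ∈ E × p ≢ z × p ∈L lineAt d (level d z)
    to p p∈ with ∈-filter⁻ (other? z d) {xs = E} p∈
    ... | p∈E , p-level , p≢z = p∈E , p≢z , level⇒on-line d (level d z) p p-level
    from : ∀ p → p ∈ E × p ≢ z × p ∈L lineAt d (level d z) → p ∈ others z d
    from p (p∈E , p≢z , p-on) = ∈-filter⁺ (other? z d) p∈E (on-line⇒level d (level d z) p p-on , p≢z)

  module Dense (q>0 : 0 < q) (dense : 64 * q ≤ N) where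
    N>0 : 0 < N
    N>0 = ≤-trans (≤-trans q>0 (m≤n*m q 64)) dense

    instance
      q≢0 : NonZero q
      q≢0 = >-nonZero q>0
      N≢0 : NonZero N
      N≢0 = >-nonZero N>0
      4q≢0 : NonZero (4 * q)
      4q≢0 = m*n≢0 4 q
      qN≢0 : NonZero (q * N)
      qN≢0 = m*n≢0 q N

    2q≤N : 2 * q ≤ N
    2q≤N = ≤-trans (*-monoˡ-≤ q (m≤m+n 2 62)) dense

    4q≤N : 4 * q ≤ N
    4q≤N = ≤-trans (*-monoˡ-≤ q (m≤m+n 4 60)) dense

    sparse? : (x : Cell) → Dec (countOf x ≤ 1)
    sparse? x = countOf x ≤? 1

    -- A line with at most one point deviates from the mean N/q by at least
    -- N/(2q), so the variance bound leaves room for few such lines.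
    sparse-weight : N * N * ∑[ x ← cells ] 𝟙 (sparse? x) ≤ 4 * (q * q * q * N)
    sparse-weight = begin
      N * N * ∑[ x ← cells ] 𝟙 (sparse? x) ≤⟨ ∑-scaled-bound cells (N * N) _ (λ x → 4 * deviation x) pointwise ⟩
      ∑[ x ← cells ] (4 * deviation x)     ≡⟨ ∑-* cells 4 deviation ⟩
      4 * ∑ cells deviation                ≤⟨ *-monoʳ-≤ 4 deviation-bound ⟩
      4 * (q * q * q * N)                  ∎
      where
      open ≤-Reasoning
      pointwise : ∀ x → N * N * 𝟙 (sparse? x) ≤ 4 * deviation x
      pointwise x = 𝟙-bound (N * N) _ (sparse? x) (λ a≤1 → sparse-deviation {q} a≤1 2q≤N)

    sparse-lines : 16 * ∑[ x ← cells ] 𝟙 (sparse? x) ≤ q * q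
    sparse-lines = *-cancelˡ-≤ (4 * q) (begin
      4 * q * (16 * S)   ≡⟨ regroup₁ q S ⟩
      64 * q * S         ≤⟨ *-monoˡ-≤ S dense ⟩
      N * S              ≤⟨ NS≤4q³ ⟩
      4 * q * q * q      ≡⟨ *-assoc (4 * q) q q ⟩
      4 * q * (q * q)    ∎)
      where
      open ≤-Reasoning
      S = ∑[ x ← cells ] 𝟙 (sparse? x)
      regroup₁ : ∀ q S → 4 * q * (16 * S) ≡ 64 * q * S
      regroup₁ = solve-∀
      regroup₂ : ∀ q N → 4 * (q * q * q * N) ≡ N * (4 * q * q * q)
      regroup₂ = solve-∀
      NS≤4q³ : N * S ≤ 4 * q * q * q
      NS≤4q³ = *-cancelˡ-≤ N (begin
        N * (N * S)          ≡⟨ *-assoc N N S ⟨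
        N * N * S            ≤⟨ sparse-weight ⟩
        4 * (q * q * q * N)  ≡⟨ regroup₂ q N ⟩
        N * (4 * q * q * q)  ∎)

    rich? : (x : Cell) → Dec (¬ countOf x ≤ 1)
    rich? x = ¬? (sparse? x)

    rich-cells : List Cell
    rich-cells = filter rich? cells

    rich-count : q * q ≤ 8 * length rich-cells
    rich-count = *-cancelˡ-≤ 2 (+-cancelʳ-≤ (q * q) _ _ (begin
      2 * (q * q) + q * q      ≤⟨ +-monoˡ-≤ (q * q) (*-monoˡ-≤ (q * q) (m≤m+n 2 13)) ⟩
      15 * (q * q) + q * q     ≡⟨ regroup (q * q) ⟩
      16 * (q * q)             ≤⟨ *-monoʳ-≤ 16 (m≤n+m (q * q) q) ⟩
      16 * (suc q * q)         ≡⟨ cong (16 *_) R+S ⟨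
      16 * (R + S)             ≡⟨ *-distribˡ-+ 16 R S ⟩
      16 * R + 16 * S          ≤⟨ +-monoʳ-≤ (16 * R) sparse-lines ⟩
      16 * R + q * q           ≡⟨ cong (_+ q * q) (*-assoc 2 8 R) ⟩
      2 * (8 * R) + q * q      ∎))
      where
      open ≤-Reasoning
      S = ∑[ x ← cells ] 𝟙 (sparse? x)
      R = length rich-cells
      regroup : ∀ n → 15 * n + n ≡ 16 * n
      regroup = solve-∀
      R+S : R + S ≡ suc q * q
      R+S = begin-equality
        R + S                                     ≡⟨ cong (_+ S) (length-filter rich? cells) ⟩
        ∑[ x ← cells ] 𝟙 (rich? x) + S             ≡⟨ +-comm _ S ⟩
        S + ∑[ x ← cells ] 𝟙 (rich? x)             ≡⟨ ∑-𝟙-partition sparse? cells ⟩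
        length cells                              ≡⟨ cell-count ⟩
        suc q * q                                 ∎

    many-generated-lines : Σ (List Line) λ Ls → PairwiseDistinct Ls × All (GeneratedBy E) Ls × q * q ≤ 8 * length Ls
    many-generated-lines =
      map lineOf rich-cells ,
      distinct-lines (λ x → x) (Unique.filter⁺ rich? (Unique.cartesianProduct⁺ (Unique.allFin⁺ (suc q)) (Unique.allFin⁺ q))) ,
      All.map⁺ (All.map (λ {x} not-sparse → rich-generated (proj₁ x) (proj₂ x) (≰⇒> not-sparse)) (All.all-filter rich? cells)) ,
      subst (λ n → q * q ≤ 8 * n) (sym (length-map lineOf rich-cells)) rich-count

    -- Is the line balanced as seen from any of its points?
    balanced-cell? : (x : Cell) → Dec (Balanced q N (countOf x ∸ 1))
    balanced-cell? x = balanced? q N (countOf x ∸ 1)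

    -- Points on unbalanced lines, counted with multiplicity, are few: an
    -- unbalanced line with a points carries deviation at least q·a·N/16.
    unbalanced-mass : ∑[ x ← cells ] (countOf x * 𝟙 (¬? (balanced-cell? x))) ≤ 16 * (q * q)
    unbalanced-mass = *-cancelˡ-≤ (q * N) (begin
      q * N * U                        ≤⟨ ∑-scaled-bound cells (q * N) _ (λ x → 16 * deviation x) pointwise ⟩
      ∑[ x ← cells ] (16 * deviation x) ≡⟨ ∑-* cells 16 deviation ⟩
      16 * ∑ cells deviation           ≤⟨ *-monoʳ-≤ 16 deviation-bound ⟩
      16 * (q * q * q * N)             ≡⟨ regroup₁ q N ⟩
      q * N * (16 * (q * q))           ∎)
      where
      open ≤-Reasoning
      U = ∑[ x ← cells ] (countOf x * 𝟙 (¬? (balanced-cell? x)))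
      regroup₁ : ∀ q N → 16 * (q * q * q * N) ≡ q * N * (16 * (q * q))
      regroup₁ = solve-∀
      regroup₂ : ∀ q N a i → q * N * (a * i) ≡ q * a * N * i
      regroup₂ = solve-∀
      pointwise : ∀ x → q * N * (countOf x * 𝟙 (¬? (balanced-cell? x))) ≤ 16 * deviation x
      pointwise x = ≤-trans (≤-reflexive (regroup₂ q N (countOf x) _))
                      (𝟙-bound (q * countOf x * N) _ (¬? (balanced-cell? x)) (unbalanced-deviation {q} {N} {countOf x} 4q≤N))

    balanced-mass : N * q ≤ 4 * ∑[ x ← cells ] (countOf x * 𝟙 (balanced-cell? x))
    balanced-mass = +-cancelʳ-≤ (3 * (N * q)) _ _ (begin
      N * q + 3 * (N * q)        ≡⟨ regroup (N * q) ⟩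
      4 * (N * q)                ≤⟨ *-monoʳ-≤ 4 (m≤m+n (N * q) N) ⟩
      4 * (N * q + N)            ≡⟨ cong (4 *_) (trans (+-comm (N * q) N) (trans (sym (*-suc N q)) (*-comm N (suc q)))) ⟩
      4 * (suc q * N)            ≡⟨ cong (4 *_) (trans (sym first-moment) (sym (∑-partition balanced-cell? cells countOf))) ⟩
      4 * (B + U)                ≡⟨ *-distribˡ-+ 4 B U ⟩
      4 * B + 4 * U              ≤⟨ +-monoʳ-≤ (4 * B) 4U≤3Nq ⟩
      4 * B + 3 * (N * q)        ∎)
      where
      open ≤-Reasoning
      B = ∑[ x ← cells ] (countOf x * 𝟙 (balanced-cell? x))
      U = ∑[ x ← cells ] (countOf x * 𝟙 (¬? (balanced-cell? x)))
      regroup : ∀ n → n + 3 * n ≡ 4 * n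
      regroup = solve-∀
      4U≤3Nq : 4 * U ≤ 3 * (N * q)
      4U≤3Nq = begin
        4 * U                 ≤⟨ *-monoʳ-≤ 4 unbalanced-mass ⟩
        4 * (16 * (q * q))    ≡⟨ regroup₂ q ⟩
        64 * q * q            ≤⟨ *-monoˡ-≤ q dense ⟩
        N * q                 ≤⟨ m≤n*m (N * q) 3 ⟩
        3 * (N * q)           ∎
        where
        regroup₂ : ∀ q → 4 * (16 * (q * q)) ≡ 64 * q * q
        regroup₂ = solve-∀

    balanced-through? : ∀ z d → Dec (Balanced q N (count d (level d z) ∸ 1))
    balanced-through? z d = balanced? q N (count d (level d z) ∸ 1)

    balanced-directions : Point → List Direction
    balanced-directions z = filter (balanced-through? z) directions

    -- Double counting: the balanced mass counts each point z of E once for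
    -- every balanced line through z.
    balanced-mass-by-points : ∑[ x ← cells ] (countOf x * 𝟙 (balanced-cell? x)) ≡ ∑[ z ← E ] length (balanced-directions z)
    balanced-mass-by-points = begin
      ∑[ x ← cells ] (countOf x * 𝟙 (balanced-cell? x))                               ≡⟨ ∑-cells _ ⟩
      ∑[ d ← directions ] ∑[ c ← levels ] (count d c * 𝟙 (balanced? q N (count d c ∸ 1))) ≡⟨ ∑-cong directions (λ d → fiber-sum d _) ⟩
      ∑[ d ← directions ] ∑[ z ← E ] 𝟙 (balanced? q N (count d (level d z) ∸ 1))       ≡⟨ ∑-swap directions E _ ⟩
      ∑[ z ← E ] ∑[ d ← directions ] 𝟙 (balanced? q N (count d (level d z) ∸ 1))       ≡⟨ ∑-cong E (λ z → length-filter _ directions) ⟨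
      ∑[ z ← E ] length (balanced-directions z)                                        ∎
      where open ≡-Reasoning

    balanced-point : Σ Point λ z → z ∈ E × q ≤ 4 * length (balanced-directions z)
    balanced-point = averaging q (λ z → 4 * length (balanced-directions z)) E N>0
      (≤-trans balanced-mass (≤-reflexive (trans (cong (4 *_) balanced-mass-by-points) (sym (∑-* E 4 _)))))

    balanced-lines-through : ∀ {z} → z ∈ E → Σ (List Line) λ Ls → PairwiseDistinct Ls ×
       length Ls ≡ length (balanced-directions z) ×
       All (λ L → z ∈L L × Σ ℕ λ k → CountOn E z L k × N ≤ 2 * q * k × q * k < 2 * N) Ls
    balanced-lines-through {z} z∈E =
      map (λ d → lineOf (through d)) (balanced-directions z) ,
      distinct-lines through (AllPairs.map (λ d≢d' e → d≢d' (cong proj₁ e))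
                                (Unique.filter⁺ (balanced-through? z) (Unique.allFin⁺ (suc q)))) ,
      length-map (λ d → lineOf (through d)) (balanced-directions z) ,
      All.map⁺ (All.map (λ {d} → pencil-line d) (All.all-filter (balanced-through? z) directions))
      where
      through : Direction → Cell
      through d = d , level d z
      pencil-line : ∀ d → Balanced q N (count d (level d z) ∸ 1) →
        z ∈L lineAt d (level d z) × Σ ℕ λ k → CountOn E z (lineAt d (level d z)) k × N ≤ 2 * q * k × q * k < 2 * N
      pencil-line d (lower , upper) =
        level⇒on-line d (level d z) z refl , count d (level d z) ∸ 1 , others-count z∈E d , lower , upper

    balanced-pencil : Σ Point λ z → z ∈ E × Σ (List Line) λ Ls → PairwiseDistinct Ls × q ≤ 4 * length Ls ×
       All (λ L → z ∈L L × Σ ℕ λ k → CountOn E z L k × N ≤ 2 * q * k × q * k < 2 * N) Ls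
    balanced-pencil =
      let z , z∈E , many = balanced-point
          Ls , distinct , length≡ , incidences = balanced-lines-through z∈E
      in z , z∈E , Ls , distinct , subst (λ n → q ≤ 4 * n) (sym length≡) many , incidences

open import Data.Nat using (_*_; _^_; _≤_; _<_; s≤s; z≤n; _≤?_)
open import Data.Nat.Properties using (≤-trans; ^-monoʳ-<; ^-monoˡ-≤; ≰⇒>; <⇒≱)
open import Data.Product using (Σ; _×_; _,_)
open import Data.List using (length)
open import Data.List.Relation.Unary.All using (All)
open import Data.List.Membership.Propositional using (_∈_)
open import Relation.Nullary using (yes; no; contradiction)

-- Comparing exponents: b^m ≤ 2^n with b ≥ 2 forces m ≤ n. This turns the
-- hypothesis q^(64 q) ≤ 2^|E|, i.e. |E| ≥ 64 q log₂ q, into |E| ≥ 64 q.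
exponent-comparison : ∀ {b m n} → 2 ≤ b → b ^ m ≤ 2 ^ n → m ≤ n
exponent-comparison {m = m} {n = n} 2≤b bᵐ≤2ⁿ with m ≤? n
... | yes m≤n = m≤n
... | no  m≰n = contradiction (≤-trans (^-monoˡ-≤ m 2≤b) bᵐ≤2ⁿ) (<⇒≱ (^-monoʳ-< 2 (s≤s (s≤s z≤n)) (≰⇒> m≰n)))

-- The theorem holds with C = 2.
theorem1p2 : Σ ℕ λ C → ∀ (q : ℕ) → C ≤ q → IsPrimePower q → (F : FieldOn q) →
    let open Plane F in
    (E : List Point) → Unique E →
    q ^ (64 * q) ≤ 2 ^ length E →
    (Σ (List Line) λ Ls → PairwiseDistinct Ls × All (GeneratedBy E) Ls ×
       q * q ≤ 8 * length Ls)
    ×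
    (Σ Point λ z → z ∈ E × Σ (List Line) λ Ls → PairwiseDistinct Ls ×
       q ≤ 4 * length Ls ×
       All (λ L → z ∈L L × Σ ℕ λ k → CountOn E z L k ×
              length E ≤ 2 * q * k × q * k < 2 * length E) Ls)
theorem1p2 = 2 , λ q 2≤q _ F E E-unique exponents →
  let open Incidences.Dense F E E-unique (≤-trans (s≤s z≤n) 2≤q) (exponent-comparison 2≤q exponents)
  in many-generated-lines , balanced-pencil
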